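{- Let $r$ be a positive even integer. Let $p$ be a prime with $p \nmid r$, let $m > r$ be an integer, and let $n = mp$. Then the $r$-distance graph of the $n$-dimensional hypercube has an independent set of size $2^{\frac{n}{p} + p - 1}$.
   Context: The $n$-dimensional hypercube has vertex set $\{0,1\}^n$ (all $0$--$1$ sequences of length $n$). The Hamming distance of two such sequences is the number of positions in which they differ. The $r$-distance graph of the $n$-dimensional hypercube is the graph on $\{0,1\}^n$ in which two vertices are adjacent if and only if their Hamming distance is exactly $r$. An independent set is a set of vertices no two of which are adjacent. -}

module Defs where

open import Data.Nat using (ℕ; zero; suc; _+_)
open import Data.Bool using (Bool; true; false; _≟_)
open import Data.Vec using (Vec; []; _∷_)
open import Data.List using (List)
open import Data.List.Relation.Unary.Unique.Propositional using (Unique)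
open import Data.List.Membership.Propositional using (_∈_)
open import Relation.Binary.PropositionalEquality using (_≡_)
open import Relation.Nullary using (¬_; yes; no)
open import Data.Product using (_×_)

Cube : ℕ → Set
Cube n = Vec Bool n

hamming : ∀ {n} → Cube n → Cube n → ℕ
hamming [] [] = 0
hamming (a ∷ u) (b ∷ v) with a ≟ b
... | yes _ = hamming u v
... | no  _ = suc (hamming u v)

Adjacent : (n r : ℕ) → Cube n → Cube n → Set
Adjacent n r u v = hamming u v ≡ r

IsIndependent : (n r : ℕ) → List (Cube n) → Set
IsIndependent n r S =
  Unique S × (∀ {u v} → u ∈ S → v ∈ S → ¬ Adjacent n r u v)

module Submission where

-- For a ∈ {0,1}^m and c ∈ {0,1}^(p-1) take the vertex of {0,1}^(mp) whose i-th block of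
-- length p is 0c, complemented when aᵢ = 1; these 2^(m+p-1) vertices are distinct. Between two
-- of them every block contributes d or p − d, where d < p is the distance of 0c and 0c′. If
-- d = 0 each block contributes 0 or p, so the distance is a multiple of p; otherwise each block
-- contributes at least 1, so the distance is at least m. As p ∤ r and r < m, no two vertices
-- are at distance r.

open import Defs
open import Data.Nat using (ℕ; _*_; _+_; _∸_; _^_; _<_)
open import Data.Nat.Divisibility using (_∣_)
open import Data.Nat.Primality using (Prime)
open import Data.List using (List; length)
open import Data.Product using (Σ; _×_)
open import Relation.Binary.PropositionalEquality using (_≡_)
open import Relation.Nullary using (¬_)

open import Data.Nat using (zero; suc; _≤_; z≤n; s≤s)
open import Data.Nat.Properties
  using (+-assoc; +-comm; +-commutativeSemigroup; +-suc; +-mono-≤; m≤n⇒m≤1+n;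
         <-irrefl; <⇒≱; ^-distribˡ-+-*)
open import Algebra.Properties.CommutativeSemigroup +-commutativeSemigroup
  using () renaming (interchange to +-interchange)
open import Data.Nat.Divisibility using (∣-refl; _∣0; ∣m∣n⇒∣m+n; ∣m+n∣m⇒∣n)
open import Data.Nat.Primality using (¬prime[0])
open import Data.Bool using (Bool; true; false; not; _xor_) renaming (_≟_ to _≟ᴮ_)
open import Data.Bool.Properties using (xor-assoc; xor-same; xor-identityʳ)
open import Data.Vec using (Vec; []; _∷_; _++_; map)
open import Data.Vec.Properties using (++-injective; ∷-injective)
open import Data.List using ([]; _∷_; cartesianProductWith)
  renaming (_++_ to _++ᴸ_; map to mapᴸ)
open import Data.List.Properties using (length-++; length-map)
open import Data.List.Relation.Unary.AllPairs using ([]; _∷_)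
open import Data.List.Relation.Unary.All using ([]; _∷_)
open import Data.List.Relation.Unary.Unique.Propositional using (Unique)
open import Data.List.Relation.Unary.Unique.Propositional.Properties using (cartesianProductWith⁺)
open import Data.List.Membership.Propositional using (_∈_)
open import Data.List.Membership.Propositional.Properties using (∈-cartesianProductWith⁻)
open import Data.Product using (_,_; proj₁; proj₂)
open import Data.Sum using (_⊎_; inj₁; inj₂)
open import Data.Empty using (⊥-elim)
open import Relation.Nullary using (yes; no)
open import Relation.Binary.PropositionalEquality
  using (refl; sym; trans; cong; cong₂; subst; module ≡-Reasoning)

bitDistance : Bool → Bool → ℕ
bitDistance false false = 0
bitDistance false true  = 1
bitDistance true  false = 1
bitDistance true  true  = 0

hamming-∷ : ∀ {n} a b (u v : Cube n) → hamming (a ∷ u) (b ∷ v) ≡ bitDistance a b + hamming u v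
hamming-∷ false false u v = refl
hamming-∷ false true  u v = refl
hamming-∷ true  false u v = refl
hamming-∷ true  true  u v = refl

hamming-++ : ∀ {k n} (u u′ : Cube k) (v v′ : Cube n) →
             hamming (u ++ v) (u′ ++ v′) ≡ hamming u u′ + hamming v v′
hamming-++ [] [] v v′ = refl
hamming-++ (a ∷ u) (b ∷ u′) v v′ = begin
  hamming (a ∷ u ++ v) (b ∷ u′ ++ v′)
    ≡⟨ hamming-∷ a b (u ++ v) (u′ ++ v′) ⟩
  bitDistance a b + hamming (u ++ v) (u′ ++ v′)
    ≡⟨ cong (bitDistance a b +_) (hamming-++ u u′ v v′) ⟩
  bitDistance a b + (hamming u u′ + hamming v v′)
    ≡⟨ +-assoc (bitDistance a b) _ _ ⟨
  (bitDistance a b + hamming u u′) + hamming v v′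
    ≡⟨ cong (_+ hamming v v′) (hamming-∷ a b u u′) ⟨
  hamming (a ∷ u) (b ∷ u′) + hamming v v′ ∎
  where open ≡-Reasoning

hamming-≤ : ∀ {n} (u v : Cube n) → hamming u v ≤ n
hamming-≤ [] [] = z≤n
hamming-≤ (a ∷ u) (b ∷ v) with a ≟ᴮ b
... | yes _ = m≤n⇒m≤1+n (hamming-≤ u v)
... | no  _ = s≤s (hamming-≤ u v)

flipIf : ∀ {n} → Bool → Cube n → Cube n
flipIf x = map (x xor_)

bitDistance-xor-same : ∀ x a b → bitDistance (x xor a) (x xor b) ≡ bitDistance a b
bitDistance-xor-same false a b = refl
bitDistance-xor-same true false false = refl
bitDistance-xor-same true false true  = refl
bitDistance-xor-same true true  false = refl
bitDistance-xor-same true true  true  = refl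

bitDistance-xor-opposite : ∀ x a b → bitDistance (x xor a) (not x xor b) + bitDistance a b ≡ 1
bitDistance-xor-opposite false false false = refl
bitDistance-xor-opposite false false true  = refl
bitDistance-xor-opposite false true  false = refl
bitDistance-xor-opposite false true  true  = refl
bitDistance-xor-opposite true  false false = refl
bitDistance-xor-opposite true  false true  = refl
bitDistance-xor-opposite true  true  false = refl
bitDistance-xor-opposite true  true  true  = refl

hamming-flipIf-same : ∀ {n} x (u v : Cube n) → hamming (flipIf x u) (flipIf x v) ≡ hamming u v
hamming-flipIf-same x [] [] = refl
hamming-flipIf-same x (a ∷ u) (b ∷ v) = begin
  hamming (flipIf x (a ∷ u)) (flipIf x (b ∷ v))                    ≡⟨ hamming-∷ (x xor a) (x xor b) _ _ ⟩
  bitDistance (x xor a) (x xor b) + hamming (flipIf x u) (flipIf x v)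
    ≡⟨ cong₂ _+_ (bitDistance-xor-same x a b) (hamming-flipIf-same x u v) ⟩
  bitDistance a b + hamming u v                                    ≡⟨ hamming-∷ a b u v ⟨
  hamming (a ∷ u) (b ∷ v)                                          ∎
  where open ≡-Reasoning

hamming-flipIf-opposite : ∀ {n} x (u v : Cube n) →
                          hamming (flipIf x u) (flipIf (not x) v) + hamming u v ≡ n
hamming-flipIf-opposite x [] [] = refl
hamming-flipIf-opposite {suc n} x (a ∷ u) (b ∷ v) = begin
  hamming (flipIf x (a ∷ u)) (flipIf (not x) (b ∷ v)) + hamming (a ∷ u) (b ∷ v)
    ≡⟨ cong₂ _+_ (hamming-∷ (x xor a) (not x xor b) _ _) (hamming-∷ a b u v) ⟩
  (bitDistance (x xor a) (not x xor b) + hamming (flipIf x u) (flipIf (not x) v))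
    + (bitDistance a b + hamming u v)
    ≡⟨ +-interchange (bitDistance (x xor a) (not x xor b)) _ (bitDistance a b) _ ⟩
  (bitDistance (x xor a) (not x xor b) + bitDistance a b)
    + (hamming (flipIf x u) (flipIf (not x) v) + hamming u v)
    ≡⟨ cong₂ _+_ (bitDistance-xor-opposite x a b) (hamming-flipIf-opposite x u v) ⟩
  suc n ∎
  where open ≡-Reasoning

hamming-flipIf : ∀ {n} x y (u v : Cube n) →
                 hamming (flipIf x u) (flipIf y v) ≡ hamming u v
                 ⊎ hamming (flipIf x u) (flipIf y v) + hamming u v ≡ n
hamming-flipIf false false u v = inj₁ (hamming-flipIf-same false u v)
hamming-flipIf true  true  u v = inj₁ (hamming-flipIf-same true u v)
hamming-flipIf false true  u v = inj₂ (hamming-flipIf-opposite false u v)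
hamming-flipIf true  false u v = inj₂ (hamming-flipIf-opposite true u v)

∣hamming⇒∣hamming-flipIf : ∀ {n} x y (u v : Cube n) →
                           n ∣ hamming u v → n ∣ hamming (flipIf x u) (flipIf y v)
∣hamming⇒∣hamming-flipIf {n} x y u v n∣d with hamming-flipIf x y u v
... | inj₁ same = subst (n ∣_) (sym same) n∣d
... | inj₂ opposite =
  ∣m+n∣m⇒∣n (subst (n ∣_) (sym (trans (+-comm (hamming u v) _) opposite)) ∣-refl) n∣d

hamming-flipIf-pos : ∀ {n} x y (u v : Cube n) → 0 < hamming u v → hamming u v < n →
                     0 < hamming (flipIf x u) (flipIf y v)
hamming-flipIf-pos x y u v 0<d d<n with hamming-flipIf x y u v
... | inj₁ same = subst (0 <_) (sym same) 0<d
... | inj₂ opposite with hamming (flipIf x u) (flipIf y v)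
...   | suc _ = s≤s z≤n
...   | zero  = ⊥-elim (<-irrefl opposite d<n)

flipBlocks : ∀ {m n} → Vec Bool m → Cube n → Cube (m * n)
flipBlocks []      u = []
flipBlocks (x ∷ a) u = flipIf x u ++ flipBlocks a u

∣hamming⇒∣hamming-flipBlocks : ∀ {m n} (a a′ : Vec Bool m) (u v : Cube n) →
                               n ∣ hamming u v → n ∣ hamming (flipBlocks a u) (flipBlocks a′ v)
∣hamming⇒∣hamming-flipBlocks [] [] u v n∣d = _ ∣0
∣hamming⇒∣hamming-flipBlocks {n = n} (x ∷ a) (y ∷ a′) u v n∣d =
  subst (n ∣_) (sym (hamming-++ (flipIf x u) (flipIf y v) _ _))
    (∣m∣n⇒∣m+n (∣hamming⇒∣hamming-flipIf x y u v n∣d)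
               (∣hamming⇒∣hamming-flipBlocks a a′ u v n∣d))

hamming-flipBlocks-≥ : ∀ {m n} (a a′ : Vec Bool m) (u v : Cube n) →
                       0 < hamming u v → hamming u v < n →
                       m ≤ hamming (flipBlocks a u) (flipBlocks a′ v)
hamming-flipBlocks-≥ [] [] u v 0<d d<n = z≤n
hamming-flipBlocks-≥ (x ∷ a) (y ∷ a′) u v 0<d d<n =
  subst (suc _ ≤_) (sym (hamming-++ (flipIf x u) (flipIf y v) _ _))
    (+-mono-≤ (hamming-flipIf-pos x y u v 0<d d<n) (hamming-flipBlocks-≥ a a′ u v 0<d d<n))

flipIf-involutive : ∀ {n} x (u : Cube n) → flipIf x (flipIf x u) ≡ u
flipIf-involutive x [] = refl
flipIf-involutive x (a ∷ u) =
  cong₂ _∷_ (trans (sym (xor-assoc x x a)) (cong (_xor a) (xor-same x)))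
            (flipIf-involutive x u)

flipIf-injective : ∀ {n} x {u v : Cube n} → flipIf x u ≡ flipIf x v → u ≡ v
flipIf-injective x {u} {v} eq = begin
  u                       ≡⟨ flipIf-involutive x u ⟨
  flipIf x (flipIf x u)   ≡⟨ cong (flipIf x) eq ⟩
  flipIf x (flipIf x v)   ≡⟨ flipIf-involutive x v ⟩
  v                       ∎
  where open ≡-Reasoning

vertex : ∀ {m q} → Vec Bool m → Cube q → Cube (m * suc q)
vertex a c = flipBlocks a (false ∷ c)

vertex-injectiveˡ : ∀ {m q} (a a′ : Vec Bool m) {c c′ : Cube q} →
                    vertex a c ≡ vertex a′ c′ → a ≡ a′
vertex-injectiveˡ [] [] eq = refl
vertex-injectiveˡ (x ∷ a) (y ∷ a′) eq
  with blockEq , restEq ← ++-injective (flipIf x (false ∷ _)) (flipIf y (false ∷ _)) eq =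
  cong₂ _∷_ x≡y (vertex-injectiveˡ a a′ restEq)
  where
  x≡y : x ≡ y
  x≡y = trans (sym (xor-identityʳ x)) (trans (proj₁ (∷-injective blockEq)) (xor-identityʳ y))

vertex-injective : ∀ {m q} {a a′ : Vec Bool (suc m)} {c c′ : Cube q} →
                   vertex a c ≡ vertex a′ c′ → a ≡ a′ × c ≡ c′
vertex-injective {a = x ∷ a} {a′} {c} {c′} eq with refl ← vertex-injectiveˡ (x ∷ a) a′ eq =
  refl , proj₂ (∷-injective (flipIf-injective x (proj₁ (++-injective (flipIf x (false ∷ c)) _ eq))))

hamming-vertex : ∀ {m q} (a a′ : Vec Bool m) (c c′ : Cube q) →
                 suc q ∣ hamming (vertex a c) (vertex a′ c′)
                 ⊎ m ≤ hamming (vertex a c) (vertex a′ c′)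
hamming-vertex a a′ c c′ with hamming c c′ in d≡ | hamming-≤ c c′
... | zero  | _   = inj₁ (∣hamming⇒∣hamming-flipBlocks a a′ _ _ (subst (_ ∣_) (sym d≡) (_ ∣0)))
... | suc d | d<q = inj₂ (hamming-flipBlocks-≥ a a′ _ _
                            (subst (0 <_) (sym d≡) (s≤s z≤n)) (subst (_< suc _) (sym d≡) (s≤s d<q)))

allCube : (n : ℕ) → List (Cube n)
allCube zero    = [] ∷ []
allCube (suc n) = cartesianProductWith _∷_ (false ∷ true ∷ []) (allCube n)

length-cartesianProductWith : ∀ {a b c} {A : Set a} {B : Set b} {C : Set c}
                              (f : A → B → C) (xs : List A) (ys : List B) →
                              length (cartesianProductWith f xs ys) ≡ length xs * length ys
length-cartesianProductWith f []       ys = refl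
length-cartesianProductWith f (x ∷ xs) ys = begin
  length (mapᴸ (f x) ys ++ᴸ cartesianProductWith f xs ys)
    ≡⟨ length-++ (mapᴸ (f x) ys) ⟩
  length (mapᴸ (f x) ys) + length (cartesianProductWith f xs ys)
    ≡⟨ cong₂ _+_ (length-map (f x) ys) (length-cartesianProductWith f xs ys) ⟩
  length ys + length xs * length ys ∎
  where open ≡-Reasoning

length-allCube : ∀ n → length (allCube n) ≡ 2 ^ n
length-allCube zero    = refl
length-allCube (suc n) =
  trans (length-cartesianProductWith _∷_ (false ∷ true ∷ []) (allCube n))
        (cong (2 *_) (length-allCube n))

allCube-unique : ∀ n → Unique (allCube n)
allCube-unique zero    = [] ∷ []
allCube-unique (suc n) =
  cartesianProductWith⁺ _∷_ ∷-injective (((λ ()) ∷ []) ∷ [] ∷ []) (allCube-unique n)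

vertices : ∀ m q → List (Cube (suc m * suc q))
vertices m q = cartesianProductWith vertex (allCube (suc m)) (allCube q)

vertices-independent : ∀ {r} m q → ¬ (suc q ∣ r) → r < suc m →
                       IsIndependent (suc m * suc q) r (vertices m q)
vertices-independent {r} m q q+1∤r r<m =
  cartesianProductWith⁺ vertex vertex-injective (allCube-unique (suc m)) (allCube-unique q) ,
  nonAdjacent
  where
  nonAdjacent : ∀ {u v} → u ∈ vertices m q → v ∈ vertices m q → ¬ Adjacent (suc m * suc q) r u v
  nonAdjacent u∈ v∈ adj
    with a , c , _ , _ , refl ← ∈-cartesianProductWith⁻ vertex (allCube (suc m)) (allCube q) u∈
       | a′ , c′ , _ , _ , refl ← ∈-cartesianProductWith⁻ vertex (allCube (suc m)) (allCube q) v∈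
    with hamming-vertex a a′ c c′
  ... | inj₁ q+1∣d = q+1∤r (subst (suc q ∣_) adj q+1∣d)
  ... | inj₂ m≤d   = <⇒≱ r<m (subst (suc m ≤_) adj m≤d)

length-vertices : ∀ m q → length (vertices m q) ≡ 2 ^ (suc m + q)
length-vertices m q = begin
  length (vertices m q)                ≡⟨ length-cartesianProductWith vertex (allCube (suc m)) (allCube q) ⟩
  length (allCube (suc m)) * length (allCube q)
    ≡⟨ cong₂ _*_ (length-allCube (suc m)) (length-allCube q) ⟩
  2 ^ suc m * 2 ^ q                    ≡⟨ ^-distribˡ-+-* 2 (suc m) q ⟨
  2 ^ (suc m + q)                      ∎
  where open ≡-Reasoning

mainTheorem1 : (r p m : ℕ) → 0 < r → 2 ∣ r → Prime p → ¬ (p ∣ r) → r < m →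
    Σ (List (Cube (m * p))) (λ S →
      IsIndependent (m * p) r S × length S ≡ 2 ^ (m + p ∸ 1))
mainTheorem1 r zero    m       _ _ p-prime _ _ = ⊥-elim (¬prime[0] p-prime)
mainTheorem1 r (suc q) zero    _ _ _ _ ()
mainTheorem1 r (suc q) (suc m) _ _ _ p∤r r<m =
  vertices m q ,
  vertices-independent m q p∤r r<m ,
  trans (length-vertices m q) (cong (2 ^_) (sym (+-suc m q)))
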